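{- Let $X$ be a set and $R \subseteq X \times X$ be collusive and surjective. Then the protection relation $\sqsupset_R$ induced by $R$ is collusive.
   Context: For a binary relation $S$ on $X$, write $xSy$ for $(x,y)\in S$. $S$ is collusive iff $\forall x,y,z,w\in X\,\big((xSy \wedge xSz \wedge wSy)\Rightarrow wSz\big)$. $R$ is surjective iff $\forall x\in X\,\exists y\in X.\ yRx$. The protection relation induced by $R$ is the binary relation $\sqsupset_R$ on $X$ defined by $x \sqsupset_R z$ iff $\forall y\in X\,(yRz \Rightarrow xRy)$. -}

module Defs where

open import Level using (Level; _⊔_)
open import Data.Product using (∃-syntax)
open import Relation.Binary.Core using (Rel)

Collusive : ∀ {a ℓ} {X : Set a} → Rel X ℓ → Set (a ⊔ ℓ)
Collusive {X = X} S = ∀ {x y z w : X} → S x y → S x z → S w y → S w z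

Surjective : ∀ {a ℓ} {X : Set a} → Rel X ℓ → Set (a ⊔ ℓ)
Surjective {X = X} R = ∀ (x : X) → ∃[ y ] R y x

Protects : ∀ {a ℓ} {X : Set a} → Rel X ℓ → Rel X (a ⊔ ℓ)
Protects {X = X} R x z = ∀ (y : X) → R y z → R x y

module Submission where

open import Defs
open import Relation.Binary.Core using (Rel)
open import Data.Product using (_,_)

mainTheorem1 : ∀ {a ℓ} {X : Set a} (R : Rel X ℓ) →
    Collusive R → Surjective R → Collusive (Protects R)
mainTheorem1 R collusive surjective {y = y} x⊐y x⊐z w⊐y v vRz =
  let u , uRy = surjective y
  in collusive (x⊐y u uRy) (x⊐z v vRz) (w⊐y u uRy)
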